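{- Let $n>2$ be an integer and let $k$ be an odd positive integer with $k<2^{n}$. Then $P_{k}(n)$, the submonoid of $(\mathbb{N},+)$ generated by $\{k2^{n+i}+1 \mid i\in\mathbb{N}\}$, is a numerical semigroup.
   Context: $\mathbb{N}$ denotes the set of non-negative integers. For a subset $A\subseteq\mathbb{N}$, $\langle A\rangle$ denotes the set of all finite sums $\sum t_a a$ with $a\in A$, $t_a\in\mathbb{N}$ (including $0$). A numerical semigroup is a subset $S\subseteq\mathbb{N}$ containing $0$, closed under addition, with $\mathbb{N}\setminus S$ finite. $P_k(n)=\langle\{k2^{n+i}+1\mid i\in\mathbb{N}\}\rangle$. -}

module Defs where

open import Data.Nat using (ℕ; zero; suc; _+_; _*_; _^_)
open import Data.Product using (Σ; ∃; _×_)
open import Data.List using (List)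
open import Data.List.Membership.Propositional using (_∈_)
open import Relation.Nullary using (¬_)
open import Relation.Binary.PropositionalEquality using (_≡_)

Subset : Set₁
Subset = ℕ → Set

data ⟨_⟩ (A : Subset) : Subset where
  gen-zero : ⟨ A ⟩ 0
  gen-elem : ∀ {a} → A a → ⟨ A ⟩ a
  gen-add  : ∀ {x y} → ⟨ A ⟩ x → ⟨ A ⟩ y → ⟨ A ⟩ (x + y)

FiniteComplement : Subset → Set
FiniteComplement S = Σ (List ℕ) λ L → ∀ x → ¬ S x → x ∈ L

IsNumericalSemigroup : Subset → Set
IsNumericalSemigroup S =
  S 0 × (∀ x y → S x → S y → S (x + y)) × FiniteComplement S

PGen : ℕ → ℕ → Subset
PGen k n x = ∃ λ i → x ≡ k * 2 ^ (n + i) + 1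

P : ℕ → ℕ → Subset
P k n = ⟨ PGen k n ⟩

Odd : ℕ → Set
Odd k = ∃ λ m → k ≡ 2 * m + 1

-- With m = k·2ⁿ, the generators for i = 0 and i = 1 are m + 1 and 2m + 1. Since
-- 2(m + 1) − (2m + 1) = 1 they are coprime, and every x ≥ (m + 1)(2m + 1) is a
-- ℕ-combination of them, so the complement of P_k(n) is finite.
{-# OPTIONS --safe #-}
module Submission where

open import Defs
open import Data.Nat using (ℕ; _<_; _^_; zero; suc; _+_; _*_; _≤_; _<?_)
open import Data.Nat.Properties
  using (+-comm; *-comm; +-identityʳ; ^-distribˡ-+-*; *-cancelʳ-≤; m≤n+m; m≤n⇒∃[o]m+o≡n; ≮⇒≥)
open import Data.Nat.Tactic.RingSolver using (solve-∀)
open import Data.Product using (∃₂; _,_)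
open import Data.List using (upTo)
open import Data.List.Membership.Propositional using (_∈_)
open import Data.List.Membership.Propositional.Properties using (∈-upTo⁺)
open import Relation.Nullary using (¬_; yes; no; contradiction)
open import Relation.Binary.PropositionalEquality
  using (_≡_; refl; sym; trans; cong; subst; module ≡-Reasoning)

Combination : ℕ → ℕ → ℕ → Set
Combination a b x = ∃₂ λ p q → p * a + q * b ≡ x

⟨⟩-*ˡ : ∀ {A a} p → ⟨ A ⟩ a → ⟨ A ⟩ (p * a)
⟨⟩-*ˡ zero    _  = gen-zero
⟨⟩-*ˡ (suc p) Sa = gen-add Sa (⟨⟩-*ˡ p Sa)

⟨⟩-combination : ∀ {A a b x} → ⟨ A ⟩ a → ⟨ A ⟩ b → Combination a b x → ⟨ A ⟩ x
⟨⟩-combination Sa Sb (p , q , refl) = gen-add (⟨⟩-*ˡ p Sa) (⟨⟩-*ˡ q Sb)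

cofinite⇒finiteComplement : ∀ {S : Subset} c → (∀ x → c ≤ x → S x) → FiniteComplement S
cofinite⇒finiteComplement {S} c S-above = upTo c , missing-below
  where
  missing-below : ∀ x → ¬ S x → x ∈ upTo c
  missing-below x x∉S with x <? c
  ... | yes x<c = ∈-upTo⁺ x<c
  ... | no  x≮c = contradiction (S-above x (≮⇒≥ x≮c)) x∉S

⟨⟩-isNumericalSemigroup : ∀ {A} c → (∀ x → c ≤ x → ⟨ A ⟩ x) →
  IsNumericalSemigroup ⟨ A ⟩
⟨⟩-isNumericalSemigroup c above =
  gen-zero , (λ _ _ → gen-add) , cofinite⇒finiteComplement c above

conductor : ℕ → ℕ
conductor m = suc m * suc (m + m)

combination-+conductor : ∀ m x →
  Combination (suc m) (suc (m + m)) (x + conductor m)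
combination-+conductor m zero = 0 , suc m , refl
combination-+conductor m (suc x) with combination-+conductor m x
... | p , suc q , e = suc (suc p) , q , trans (trade p q m) (cong suc e)
  where
  -- 2(m + 1) = (2m + 1) + 1
  trade : ∀ p q m → suc (suc p) * suc m + q * suc (m + m)
                    ≡ suc (p * suc m + suc q * suc (m + m))
  trade = solve-∀
... | p , zero , e with m≤n⇒∃[o]m+o≡n (enough-a p e)
  where
  enough-a : ∀ p → p * suc m + 0 ≡ x + conductor m → suc (m + m) ≤ p
  enough-a p e = *-cancelʳ-≤ (suc (m + m)) p (suc m) (begin
    suc (m + m) * suc m  ≡⟨ *-comm (suc (m + m)) (suc m) ⟩
    conductor m          ≤⟨ m≤n+m (conductor m) x ⟩
    x + conductor m      ≡⟨ sym e ⟩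
    p * suc m + 0        ≡⟨ +-identityʳ _ ⟩
    p * suc m            ∎)
    where open Data.Nat.Properties.≤-Reasoning
... | p′ , refl = suc (suc p′) , m , trans (trade p′ m) (cong suc e)
  where
  -- (2m + 1)(m + 1) = (m + 1) + m(2m + 1): trade 2m + 1 copies of m + 1 for m copies of 2m + 1
  trade : ∀ p′ m → suc (suc p′) * suc m + m * suc (m + m)
                   ≡ suc ((suc (m + m) + p′) * suc m + 0 * suc (m + m))
  trade = solve-∀

combination-≥conductor : ∀ m x → conductor m ≤ x →
  Combination (suc m) (suc (m + m)) x
combination-≥conductor m x c≤x with m≤n⇒∃[o]m+o≡n c≤x
... | y , refl = subst (Combination _ _) (+-comm y (conductor m)) (combination-+conductor m y)

module _ (k n : ℕ) where

  P-gen₀ : P k n (suc (k * 2 ^ n))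
  P-gen₀ = gen-elem (0 , (begin
    suc (k * 2 ^ n)        ≡⟨ +-comm 1 _ ⟩
    k * 2 ^ n + 1          ≡⟨ cong (λ j → k * 2 ^ j + 1) (sym (+-identityʳ n)) ⟩
    k * 2 ^ (n + 0) + 1    ∎))
    where open ≡-Reasoning

  P-gen₁ : P k n (suc (k * 2 ^ n + k * 2 ^ n))
  P-gen₁ = gen-elem (1 , (begin
    suc (k * 2 ^ n + k * 2 ^ n)  ≡⟨ +-comm 1 _ ⟩
    k * 2 ^ n + k * 2 ^ n + 1    ≡⟨ cong (_+ 1) (double k (2 ^ n)) ⟩
    k * (2 ^ n * 2) + 1          ≡⟨ cong (λ t → k * t + 1) (sym (^-distribˡ-+-* 2 n 1)) ⟩
    k * 2 ^ (n + 1) + 1          ∎))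
    where
    open ≡-Reasoning
    double : ∀ k t → k * t + k * t ≡ k * (t * 2)
    double = solve-∀

theorem2 : (n k : ℕ) → 2 < n → Odd k → k < 2 ^ n →
    IsNumericalSemigroup (P k n)
theorem2 n k _ _ _ = ⟨⟩-isNumericalSemigroup (conductor (k * 2 ^ n)) λ x c≤x →
  ⟨⟩-combination (P-gen₀ k n) (P-gen₁ k n)
    (combination-≥conductor (k * 2 ^ n) x c≤x)
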